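{- Let $L$ be a separably closed field, and let $d \geq 2$ be an integer with $d = 1$ in $L$. Then there is no squarefree polynomial $f \in L[x]$ of degree at least 2 whose Newton map $N_f$ has degree $d$.
   Context: The Newton map of a squarefree polynomial $f \in L[x]$ of degree at least 2 is $N_f(x) = x - f(x)/f'(x) \in L(x)$. "$d = 1$ in $L$" refers to the image of the integer $d$ in $L$. -}

module Defs where

open import Level using (Level; _⊔_) renaming (suc to lsuc)
open import Algebra.Bundles using (CommutativeRing)
open import Data.Nat using (ℕ; zero; suc; _<_; _≤_)
open import Data.List using (List; []; _∷_)
open import Data.Product using (Σ; ∃; _×_; _,_)
open import Data.Sum using (_⊎_)
open import Relation.Nullary using (¬_)

record Field (c ℓ : Level) : Set (lsuc (c ⊔ ℓ)) where
  field
    commutativeRing : CommutativeRing c ℓ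
  open CommutativeRing commutativeRing public
  field
    0≉1     : ¬ (0# ≈ 1#)
    inverse : ∀ x → ¬ (x ≈ 0#) → ∃ λ y → x * y ≈ 1#

module FieldPoly {c ℓ : Level} (F : Field c ℓ) where
  open Field F

  ι : ℕ → Carrier
  ι zero    = 0#
  ι (suc n) = 1# + ι n

  -- polynomials in L[x] as coefficient lists, lowest degree first
  Poly : Set c
  Poly = List Carrier

  coeff : Poly → ℕ → Carrier
  coeff []      _       = 0#
  coeff (a ∷ p) zero    = a
  coeff (a ∷ p) (suc n) = coeff p n

  _≈ₚ_ : Poly → Poly → Set ℓ
  p ≈ₚ q = ∀ n → coeff p n ≈ coeff q n

  0ₚ : Poly
  0ₚ = []

  1ₚ : Poly
  1ₚ = 1# ∷ []

  X : Poly
  X = 0# ∷ 1# ∷ []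

  _+ₚ_ : Poly → Poly → Poly
  []      +ₚ q       = q
  (a ∷ p) +ₚ []      = a ∷ p
  (a ∷ p) +ₚ (b ∷ q) = (a + b) ∷ (p +ₚ q)

  scale : Carrier → Poly → Poly
  scale a []      = []
  scale a (b ∷ q) = (a * b) ∷ scale a q

  -ₚ_ : Poly → Poly
  -ₚ p = scale (- 1#) p

  _-ₚ_ : Poly → Poly → Poly
  p -ₚ q = p +ₚ (-ₚ q)

  _*ₚ_ : Poly → Poly → Poly
  []      *ₚ q = []
  (a ∷ p) *ₚ q = scale a q +ₚ (0# ∷ (p *ₚ q))

  derivFrom : ℕ → Poly → Poly
  derivFrom k []      = []
  derivFrom k (a ∷ p) = (ι k * a) ∷ derivFrom (suc k) p

  deriv : Poly → Poly
  deriv []      = []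
  deriv (_ ∷ p) = derivFrom 1 p

  eval : Poly → Carrier → Carrier
  eval []      r = 0#
  eval (a ∷ p) r = a + r * eval p r

  DegLE : Poly → ℕ → Set ℓ
  DegLE p n = ∀ m → n < m → coeff p m ≈ 0#

  -- p has degree exactly n (the zero polynomial has no degree)
  HasDegree : Poly → ℕ → Set ℓ
  HasDegree p n = ¬ (coeff p n ≈ 0#) × DegLE p n

  NonConstant : Poly → Set ℓ
  NonConstant p = ∃ λ n → (1 ≤ n) × HasDegree p n

  _∣ₚ_ : Poly → Poly → Set (c ⊔ ℓ)
  g ∣ₚ f = ∃ λ h → (g *ₚ h) ≈ₚ f

  -- coprime (gcd = 1), via Bézout in L[x]
  Coprime : Poly → Poly → Set (c ⊔ ℓ)
  Coprime p q = ∃ λ a → ∃ λ b → ((a *ₚ p) +ₚ (b *ₚ q)) ≈ₚ 1ₚ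

  Squarefree : Poly → Set (c ⊔ ℓ)
  Squarefree f = ¬ (f ≈ₚ 0ₚ) × (∀ g → NonConstant g → ¬ ((g *ₚ g) ∣ₚ f))

  Separable : Poly → Set (c ⊔ ℓ)
  Separable g = Coprime g (deriv g)

  SeparablyClosed : Set (c ⊔ ℓ)
  SeparablyClosed = ∀ g → NonConstant g → Separable g → ∃ λ r → eval g r ≈ 0#

  -- max(deg p, deg q) = d  (zero polynomial counted as having degree ≤ anything)
  MaxDeg : Poly → Poly → ℕ → Set ℓ
  MaxDeg p q d = (HasDegree p d × DegLE q d) ⊎ (HasDegree q d × DegLE p d)

  -- the rational function p / q (q ≠ 0) has degree d:
  -- written in lowest terms p₀ / q₀, max(deg p₀, deg q₀) = d
  RatDegree : Poly → Poly → ℕ → Set (c ⊔ ℓ)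
  RatDegree p q d = ∃ λ p₀ → ∃ λ q₀ →
    ¬ (q₀ ≈ₚ 0ₚ) × Coprime p₀ q₀ × ((p₀ *ₚ q) ≈ₚ (q₀ *ₚ p)) × MaxDeg p₀ q₀ d

  -- Newton map N_f = x - f/f' = (x f' - f) / f', defined when f' ≠ 0
  NewtonDegree : Poly → ℕ → Set (c ⊔ ℓ)
  NewtonDegree f d = ¬ (deriv f ≈ₚ 0ₚ) × RatDegree ((X *ₚ deriv f) -ₚ f) (deriv f) d

module Submission where

-- Let f be squarefree and write N_f = (x f' − f)/f' = p/q in lowest terms, with
-- Bézout relation α p + β q = 1. Put A = x q − p. Then
--   (1) g = β f' + α (x f' − f) is a common cofactor: f = A g and f' = q g;
--   (2) differentiating f = A g gives (q − A') g = A g';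
--   (3) f = A g squarefree makes A and g coprime, so g divides a constant
--       multiple of g', which has smaller degree; hence q = A' and p = x A' − A;
--   (4) the coefficient of x^n in x A' − A is (n − 1) Aₙ, and comparing top
--       coefficients shows that (x A' − A)/A' has no degree d with d = 1 in L.
-- The argument works over every field.
--
-- Equality in L is not decidable, so case distinctions on vanishing coefficients
-- are made under a double negation; this is harmless since the theorem is a negation.

open import Defs
open import Level using (Level; _⊔_)
open import Algebra.Bundles using (CommutativeRing)
open import Data.Nat using (ℕ; zero; suc; _≤_)
open import Data.List using ([]; _∷_)
open import Data.Product using (∃; _×_; _,_; proj₁; proj₂)
open import Data.Sum using (_⊎_; inj₁; inj₂)
open import Data.Empty using (⊥; ⊥-elim)
open import Relation.Nullary using (¬_)
import Relation.Binary.Reasoning.Setoid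

module CommutativeRingFacts {c ℓ : Level} (R : CommutativeRing c ℓ) where
  open CommutativeRing R
  open import Algebra.Properties.Ring ring using ([y-z]x≈yx-zx; ⁻¹-anti-homo-//)
  open import Algebra.Properties.AbelianGroup +-abelianGroup using (xyx⁻¹≈y)
  open import Algebra.Solver.Ring.NaturalCoefficients.Default commutativeSemiring
    using (solve; _:+_; _:*_; _:=_)
  open import Relation.Binary.Reasoning.Setoid setoid

  x-[x-y]≈y : ∀ x y → x - (x - y) ≈ y
  x-[x-y]≈y x y = begin
    x - (x - y)  ≈⟨ +-congˡ (⁻¹-anti-homo-// x y) ⟩
    x + (y - x)  ≈⟨ +-assoc x y (- x) ⟨
    (x + y) - x  ≈⟨ xyx⁻¹≈y x y ⟩
    y            ∎

  [x+y]+[z-x]≈z+y : ∀ x y z → (x + y) + (z - x) ≈ z + y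
  [x+y]+[z-x]≈z+y x y z = begin
    (x + y) + (z - x)  ≈⟨ solve 4 (λ x y z n → (x :+ y) :+ (z :+ n) := (z :+ y) :+ (x :+ n)) refl x y z (- x) ⟩
    (z + y) + (x - x)  ≈⟨ +-congˡ (-‿inverseʳ x) ⟩
    (z + y) + 0#       ≈⟨ +-identityʳ (z + y) ⟩
    z + y              ∎

  common-cofactor : ∀ {p q N D α β} → α * p + β * q ≈ 1# → p * D ≈ q * N →
                    p * (β * D + α * N) ≈ N × q * (β * D + α * N) ≈ D
  common-cofactor {p} {q} {N} {D} {α} {β} bézout cross = numerator , denominator
    where
    numerator : p * (β * D + α * N) ≈ N
    numerator = begin
      p * (β * D + α * N)        ≈⟨ solve 5 (λ p N D α β → p :* (β :* D :+ α :* N) := β :* (p :* D) :+ α :* (p :* N)) refl p N D α β ⟩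
      β * (p * D) + α * (p * N)  ≈⟨ +-congʳ (*-congˡ cross) ⟩
      β * (q * N) + α * (p * N)  ≈⟨ solve 5 (λ p q N α β → β :* (q :* N) :+ α :* (p :* N) := (α :* p :+ β :* q) :* N) refl p q N α β ⟩
      (α * p + β * q) * N        ≈⟨ *-congʳ bézout ⟩
      1# * N                     ≈⟨ *-identityˡ N ⟩
      N                          ∎
    denominator : q * (β * D + α * N) ≈ D
    denominator = begin
      q * (β * D + α * N)        ≈⟨ solve 5 (λ q N D α β → q :* (β :* D :+ α :* N) := β :* (q :* D) :+ α :* (q :* N)) refl q N D α β ⟩
      β * (q * D) + α * (q * N)  ≈⟨ +-congˡ (*-congˡ cross) ⟨
      β * (q * D) + α * (p * D)  ≈⟨ solve 5 (λ p q D α β → β :* (q :* D) :+ α :* (p :* D) := (α :* p :+ β :* q) :* D) refl p q D α β ⟩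
      (α * p + β * q) * D        ≈⟨ *-congʳ bézout ⟩
      1# * D                     ≈⟨ *-identityˡ D ⟩
      D                          ∎

  newton-factor : ∀ {x p q g f D} → p * g ≈ x * D - f → q * g ≈ D → (x * q - p) * g ≈ f
  newton-factor {x} {p} {q} {g} {f} {D} pg qg = begin
    (x * q - p) * g      ≈⟨ [y-z]x≈yx-zx g (x * q) p ⟩
    (x * q) * g - p * g  ≈⟨ +-cong (trans (*-assoc x q g) (*-congˡ qg)) (-‿cong pg) ⟩
    x * D - (x * D - f)  ≈⟨ x-[x-y]≈y (x * D) f ⟩
    f                    ∎

  [q-a]g≈b : ∀ {q a g b} → q * g ≈ a * g + b → (q - a) * g ≈ b
  [q-a]g≈b {q} {a} {g} {b} qg = begin
    (q - a) * g          ≈⟨ [y-z]x≈yx-zx g q a ⟩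
    q * g - a * g        ≈⟨ +-congʳ qg ⟩
    (a * g + b) - a * g  ≈⟨ xyx⁻¹≈y (a * g) b ⟩
    b                    ∎

  bézout-cofactor : ∀ {e g A g' s t k} → e * g ≈ A * g' → s * A + t * g ≈ k →
                    g * (s * e + t * g') ≈ k * g'
  bézout-cofactor {e} {g} {A} {g'} {s} {t} {k} eg bézout = begin
    g * (s * e + t * g')         ≈⟨ solve 5 (λ e g g' s t → g :* (s :* e :+ t :* g') := s :* (e :* g) :+ t :* (g :* g')) refl e g g' s t ⟩
    s * (e * g) + t * (g * g')   ≈⟨ +-congʳ (*-congˡ eg) ⟩
    s * (A * g') + t * (g * g')  ≈⟨ solve 5 (λ g A g' s t → s :* (A :* g') :+ t :* (g :* g') := (s :* A :+ t :* g) :* g') refl g A g' s t ⟩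
    (s * A + t * g) * g'         ≈⟨ *-congʳ bézout ⟩
    k * g'                       ∎

  annihilated : ∀ {e g A g' k} → e * g ≈ A * g' → k * g' ≈ 0# → g * (k * e) ≈ 0#
  annihilated {e} {g} {A} {g'} {k} eg kg' = begin
    g * (k * e)   ≈⟨ solve 3 (λ e g k → g :* (k :* e) := k :* (e :* g)) refl e g k ⟩
    k * (e * g)   ≈⟨ *-congˡ eg ⟩
    k * (A * g')  ≈⟨ solve 3 (λ A g' k → k :* (A :* g') := A :* (k :* g')) refl A g' k ⟩
    A * (k * g')  ≈⟨ *-congˡ kg' ⟩
    A * 0#        ≈⟨ zeroʳ A ⟩
    0#            ∎

  square-divides-product : ∀ {k a' b' a b} → k * a' ≈ a → k * b' ≈ b → (k * k) * (a' * b') ≈ a * b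
  square-divides-product {k} {a'} {b'} {a} {b} ka kb = begin
    (k * k) * (a' * b')  ≈⟨ solve 3 (λ k a' b' → (k :* k) :* (a' :* b') := (k :* a') :* (k :* b')) refl k a' b' ⟩
    (k * a') * (k * b')  ≈⟨ *-cong ka kb ⟩
    a * b                ∎

  euclid-divides : ∀ {u v r Q k v' r'} → u ≈ Q * v + r → k * v' ≈ v → k * r' ≈ r →
                   k * (Q * v' + r') ≈ u
  euclid-divides {u} {v} {r} {Q} {k} {v'} {r'} division kv kr = begin
    k * (Q * v' + r')      ≈⟨ solve 4 (λ k Q v' r' → k :* (Q :* v' :+ r') := Q :* (k :* v') :+ k :* r') refl k Q v' r' ⟩
    Q * (k * v') + k * r'  ≈⟨ +-cong (*-congˡ kv) kr ⟩
    Q * v + r              ≈⟨ division ⟨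
    u                      ∎

  euclid-bézout : ∀ {u v r Q k s t} → u ≈ Q * v + r → s * v + t * r ≈ k →
                  t * u + (s - t * Q) * v ≈ k
  euclid-bézout {u} {v} {r} {Q} {k} {s} {t} division bézout = begin
    t * u + (s - t * Q) * v                       ≈⟨ +-cong (*-congˡ division) ([y-z]x≈yx-zx v s (t * Q)) ⟩
    t * (Q * v + r) + (s * v - (t * Q) * v)       ≈⟨ +-congʳ (solve 4 (λ t Q v r → t :* (Q :* v :+ r) := (t :* Q) :* v :+ t :* r) refl t Q v r) ⟩
    ((t * Q) * v + t * r) + (s * v - (t * Q) * v) ≈⟨ [x+y]+[z-x]≈z+y ((t * Q) * v) (t * r) (s * v) ⟩
    s * v + t * r                                 ≈⟨ bézout ⟩
    k                                             ∎

module PolynomialRing {c ℓ : Level} (F : Field c ℓ) where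
  open Field F hiding (zero)
  open FieldPoly F
  open import Algebra.Properties.Ring ring using (-1*x≈-x)
  open import Algebra.Properties.CommutativeSemigroup +-commutativeSemigroup
    using (interchange; x∙yz≈y∙xz)
  open import Relation.Binary.Reasoning.Setoid setoid

  -- Coefficientwise equality _≈ₚ_, wrapped in a record so that the two
  -- polynomials can be inferred from a proof.
  infix 4 _≋_
  record _≋_ (p q : Poly) : Set ℓ where
    constructor mk
    field at : p ≈ₚ q
  open _≋_ public

  ≋-refl : ∀ {p} → p ≋ p
  ≋-refl = mk λ n → refl

  ≋-sym : ∀ {p q} → p ≋ q → q ≋ p
  ≋-sym h = mk λ n → sym (at h n)

  ≋-trans : ∀ {p q r} → p ≋ q → q ≋ r → p ≋ r
  ≋-trans h k = mk λ n → trans (at h n) (at k n)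

  cons-cong : ∀ {a b p q} → a ≈ b → p ≋ q → (a ∷ p) ≋ (b ∷ q)
  cons-cong a≈b p≋q = mk λ { zero → a≈b ; (suc n) → at p≋q n }

  coeff-+ : ∀ p q n → coeff (p +ₚ q) n ≈ coeff p n + coeff q n
  coeff-+ []      q       n       = sym (+-identityˡ _)
  coeff-+ (a ∷ p) []      n       = sym (+-identityʳ _)
  coeff-+ (a ∷ p) (b ∷ q) zero    = refl
  coeff-+ (a ∷ p) (b ∷ q) (suc n) = coeff-+ p q n

  coeff-scale : ∀ a p n → coeff (scale a p) n ≈ a * coeff p n
  coeff-scale a []      n       = sym (zeroʳ a)
  coeff-scale a (b ∷ p) zero    = refl
  coeff-scale a (b ∷ p) (suc n) = coeff-scale a p n

  coeff-neg : ∀ p n → coeff (-ₚ p) n ≈ - coeff p n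
  coeff-neg p n = trans (coeff-scale (- 1#) p n) (-1*x≈-x _)

  coeff-*-zero : ∀ a p q → coeff ((a ∷ p) *ₚ q) zero ≈ a * coeff q zero
  coeff-*-zero a p q = trans (coeff-+ (scale a q) (0# ∷ (p *ₚ q)) zero)
                             (trans (+-identityʳ _) (coeff-scale a q zero))

  coeff-*-suc : ∀ a p q n → coeff ((a ∷ p) *ₚ q) (suc n) ≈ a * coeff q (suc n) + coeff (p *ₚ q) n
  coeff-*-suc a p q n = trans (coeff-+ (scale a q) (0# ∷ (p *ₚ q)) (suc n))
                              (+-congʳ (coeff-scale a q (suc n)))

  +ₚ-cong : ∀ {p p' q q'} → p ≋ p' → q ≋ q' → (p +ₚ q) ≋ (p' +ₚ q')
  +ₚ-cong {p} {p'} {q} {q'} h k =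
    mk λ n → trans (coeff-+ p q n) (trans (+-cong (at h n) (at k n)) (sym (coeff-+ p' q' n)))

  scale-cong : ∀ {a b p q} → a ≈ b → p ≋ q → scale a p ≋ scale b q
  scale-cong {a} {b} {p} {q} a≈b h =
    mk λ n → trans (coeff-scale a p n) (trans (*-cong a≈b (at h n)) (sym (coeff-scale b q n)))

  -ₚ-cong : ∀ {p q} → p ≋ q → (-ₚ p) ≋ (-ₚ q)
  -ₚ-cong = scale-cong refl

  *ₚ-vanishesˡ : ∀ {p} q → p ≋ 0ₚ → (p *ₚ q) ≋ 0ₚ
  *ₚ-vanishesˡ {[]}    q h = ≋-refl
  *ₚ-vanishesˡ {a ∷ p} q h = mk λ
    { zero    → trans (coeff-*-zero a p q) (a≈0⇒a*x≈0 _)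
    ; (suc n) → trans (coeff-*-suc a p q n)
                  (trans (+-cong (a≈0⇒a*x≈0 _) (at (*ₚ-vanishesˡ {p} q (mk λ m → at h (suc m))) n))
                         (+-identityˡ 0#)) }
    where
    a≈0⇒a*x≈0 : ∀ x → a * x ≈ 0#
    a≈0⇒a*x≈0 x = trans (*-congʳ (at h zero)) (zeroˡ x)

  *ₚ-congˡ : ∀ {p p'} q → p ≋ p' → (p *ₚ q) ≋ (p' *ₚ q)
  *ₚ-congˡ {[]}    {p'}     q h = ≋-sym (*ₚ-vanishesˡ q (≋-sym h))
  *ₚ-congˡ {a ∷ p} {[]}     q h = *ₚ-vanishesˡ q h
  *ₚ-congˡ {a ∷ p} {b ∷ p'} q h =
    +ₚ-cong (scale-cong (at h zero) ≋-refl) (cons-cong refl (*ₚ-congˡ {p} {p'} q (mk λ m → at h (suc m))))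

  *ₚ-congʳ : ∀ p {q q'} → q ≋ q' → (p *ₚ q) ≋ (p *ₚ q')
  *ₚ-congʳ []      h = ≋-refl
  *ₚ-congʳ (a ∷ p) h = +ₚ-cong (scale-cong refl h) (cons-cong refl (*ₚ-congʳ p h))

  *ₚ-cong : ∀ {p p' q q'} → p ≋ p' → q ≋ q' → (p *ₚ q) ≋ (p' *ₚ q')
  *ₚ-cong {p} {p'} {q} h k = ≋-trans (*ₚ-congˡ q h) (*ₚ-congʳ p' k)

  +ₚ-comm : ∀ p q → (p +ₚ q) ≋ (q +ₚ p)
  +ₚ-comm p q = mk λ n → trans (coeff-+ p q n) (trans (+-comm _ _) (sym (coeff-+ q p n)))

  +ₚ-assoc : ∀ p q r → ((p +ₚ q) +ₚ r) ≋ (p +ₚ (q +ₚ r))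
  +ₚ-assoc p q r = mk λ n → begin
    coeff ((p +ₚ q) +ₚ r) n              ≈⟨ trans (coeff-+ (p +ₚ q) r n) (+-congʳ (coeff-+ p q n)) ⟩
    (coeff p n + coeff q n) + coeff r n  ≈⟨ +-assoc _ _ _ ⟩
    coeff p n + (coeff q n + coeff r n)  ≈⟨ trans (coeff-+ p (q +ₚ r) n) (+-congˡ (coeff-+ q r n)) ⟨
    coeff (p +ₚ (q +ₚ r)) n              ∎

  +ₚ-identityʳ : ∀ p → (p +ₚ 0ₚ) ≋ p
  +ₚ-identityʳ p = mk λ n → trans (coeff-+ p [] n) (+-identityʳ _)

  +ₚ-inverseʳ : ∀ p → (p +ₚ (-ₚ p)) ≋ 0ₚ
  +ₚ-inverseʳ p = mk λ n → trans (coeff-+ p (-ₚ p) n) (trans (+-congˡ (coeff-neg p n)) (-‿inverseʳ _))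

  +ₚ-inverseˡ : ∀ p → ((-ₚ p) +ₚ p) ≋ 0ₚ
  +ₚ-inverseˡ p = ≋-trans (+ₚ-comm (-ₚ p) p) (+ₚ-inverseʳ p)

  +ₚ-interchange : ∀ p q r s → ((p +ₚ q) +ₚ (r +ₚ s)) ≋ ((p +ₚ r) +ₚ (q +ₚ s))
  +ₚ-interchange p q r s = mk λ n → begin
    coeff ((p +ₚ q) +ₚ (r +ₚ s)) n                     ≈⟨ expand p q r s n ⟩
    (coeff p n + coeff q n) + (coeff r n + coeff s n)  ≈⟨ interchange _ _ _ _ ⟩
    (coeff p n + coeff r n) + (coeff q n + coeff s n)  ≈⟨ expand p r q s n ⟨
    coeff ((p +ₚ r) +ₚ (q +ₚ s)) n                     ∎
    where
    expand : ∀ p q r s n → coeff ((p +ₚ q) +ₚ (r +ₚ s)) n ≈ (coeff p n + coeff q n) + (coeff r n + coeff s n)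
    expand p q r s n = trans (coeff-+ (p +ₚ q) (r +ₚ s) n) (+-cong (coeff-+ p q n) (coeff-+ r s n))

  shift-+ : ∀ p q → (0# ∷ (p +ₚ q)) ≋ ((0# ∷ p) +ₚ (0# ∷ q))
  shift-+ p q = cons-cong (sym (+-identityʳ 0#)) ≋-refl

  scale-distribˡ : ∀ a p q → scale a (p +ₚ q) ≋ (scale a p +ₚ scale a q)
  scale-distribˡ a p q = mk λ n → begin
    coeff (scale a (p +ₚ q)) n             ≈⟨ trans (coeff-scale a (p +ₚ q) n) (*-congˡ (coeff-+ p q n)) ⟩
    a * (coeff p n + coeff q n)            ≈⟨ distribˡ _ _ _ ⟩
    a * coeff p n + a * coeff q n          ≈⟨ trans (coeff-+ (scale a p) (scale a q) n) (+-cong (coeff-scale a p n) (coeff-scale a q n)) ⟨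
    coeff (scale a p +ₚ scale a q) n       ∎

  scale-distribʳ : ∀ a b p → scale (a + b) p ≋ (scale a p +ₚ scale b p)
  scale-distribʳ a b p = mk λ n → begin
    coeff (scale (a + b) p) n              ≈⟨ coeff-scale (a + b) p n ⟩
    (a + b) * coeff p n                    ≈⟨ distribʳ _ _ _ ⟩
    a * coeff p n + b * coeff p n          ≈⟨ trans (coeff-+ (scale a p) (scale b p) n) (+-cong (coeff-scale a p n) (coeff-scale b p n)) ⟨
    coeff (scale a p +ₚ scale b p) n       ∎

  *ₚ-distribˡ : ∀ p q r → (p *ₚ (q +ₚ r)) ≋ ((p *ₚ q) +ₚ (p *ₚ r))
  *ₚ-distribˡ []      q r = ≋-refl
  *ₚ-distribˡ (a ∷ p) q r =
    ≋-trans (+ₚ-cong (scale-distribˡ a q r) (≋-trans (cons-cong refl (*ₚ-distribˡ p q r)) (shift-+ (p *ₚ q) (p *ₚ r))))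
            (+ₚ-interchange (scale a q) (scale a r) (0# ∷ (p *ₚ q)) (0# ∷ (p *ₚ r)))

  *ₚ-distribʳ : ∀ r p q → ((p +ₚ q) *ₚ r) ≋ ((p *ₚ r) +ₚ (q *ₚ r))
  *ₚ-distribʳ r []      q       = ≋-refl
  *ₚ-distribʳ r (a ∷ p) []      = ≋-sym (+ₚ-identityʳ _)
  *ₚ-distribʳ r (a ∷ p) (b ∷ q) =
    ≋-trans (+ₚ-cong (scale-distribʳ a b r) (≋-trans (cons-cong refl (*ₚ-distribʳ r p q)) (shift-+ (p *ₚ r) (q *ₚ r))))
            (+ₚ-interchange (scale a r) (scale b r) (0# ∷ (p *ₚ r)) (0# ∷ (q *ₚ r)))

  *ₚ-zeroʳ : ∀ p → (p *ₚ 0ₚ) ≋ 0ₚ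
  *ₚ-zeroʳ []      = ≋-refl
  *ₚ-zeroʳ (a ∷ p) = mk λ
    { zero    → trans (coeff-*-zero a p []) (zeroʳ a)
    ; (suc n) → trans (coeff-*-suc a p [] n) (trans (+-cong (zeroʳ a) (at (*ₚ-zeroʳ p) n)) (+-identityˡ 0#)) }

  *ₚ-cons : ∀ p b q → (p *ₚ (b ∷ q)) ≋ (scale b p +ₚ (0# ∷ (p *ₚ q)))
  *ₚ-cons []      b q = mk λ { zero → refl ; (suc n) → refl }
  *ₚ-cons (a ∷ p) b q = mk λ
    { zero    → trans (coeff-*-zero a p (b ∷ q)) (trans (*-comm a b) (sym (+-identityʳ _)))
    ; (suc n) → begin
        coeff ((a ∷ p) *ₚ (b ∷ q)) (suc n)             ≈⟨ coeff-*-suc a p (b ∷ q) n ⟩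
        a * coeff q n + coeff (p *ₚ (b ∷ q)) n         ≈⟨ +-congˡ (trans (at (*ₚ-cons p b q) n) (unfold b p (p *ₚ q) n)) ⟩
        a * coeff q n + (b * coeff p n + coeff (0# ∷ (p *ₚ q)) n)
                                                       ≈⟨ x∙yz≈y∙xz _ _ _ ⟩
        b * coeff p n + (a * coeff q n + coeff (0# ∷ (p *ₚ q)) n)
                                                       ≈⟨ +-congˡ (unfold a q (p *ₚ q) n) ⟨
        b * coeff p n + coeff ((a ∷ p) *ₚ q) n         ≈⟨ unfold b (a ∷ p) ((a ∷ p) *ₚ q) (suc n) ⟨
        coeff (scale b (a ∷ p) +ₚ (0# ∷ ((a ∷ p) *ₚ q))) (suc n) ∎ }
    where
    unfold : ∀ b p r n → coeff (scale b p +ₚ (0# ∷ r)) n ≈ b * coeff p n + coeff (0# ∷ r) n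
    unfold b p r n = trans (coeff-+ (scale b p) (0# ∷ r) n) (+-congʳ (coeff-scale b p n))

  *ₚ-comm : ∀ p q → (p *ₚ q) ≋ (q *ₚ p)
  *ₚ-comm []      q = ≋-sym (*ₚ-zeroʳ q)
  *ₚ-comm (a ∷ p) q = ≋-trans (+ₚ-cong ≋-refl (cons-cong refl (*ₚ-comm p q))) (≋-sym (*ₚ-cons q a p))

  scale-*ₚ : ∀ a p q → (scale a p *ₚ q) ≋ scale a (p *ₚ q)
  scale-*ₚ a []      q = ≋-refl
  scale-*ₚ a (b ∷ p) q =
    ≋-trans (+ₚ-cong scale-scale (cons-cong (sym (zeroʳ a)) (scale-*ₚ a p q)))
            (≋-sym (scale-distribˡ a (scale b q) (0# ∷ (p *ₚ q))))
    where
    scale-scale : scale (a * b) q ≋ scale a (scale b q)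
    scale-scale = mk λ n → begin
      coeff (scale (a * b) q) n      ≈⟨ coeff-scale (a * b) q n ⟩
      (a * b) * coeff q n            ≈⟨ *-assoc a b _ ⟩
      a * (b * coeff q n)            ≈⟨ trans (coeff-scale a (scale b q) n) (*-congˡ (coeff-scale b q n)) ⟨
      coeff (scale a (scale b q)) n  ∎

  shift-*ₚ : ∀ p q → ((0# ∷ p) *ₚ q) ≋ (0# ∷ (p *ₚ q))
  shift-*ₚ p q = mk λ
    { zero    → trans (coeff-*-zero 0# p q) (zeroˡ _)
    ; (suc n) → trans (coeff-*-suc 0# p q n) (trans (+-congʳ (zeroˡ _)) (+-identityˡ _)) }

  *ₚ-assoc : ∀ p q r → ((p *ₚ q) *ₚ r) ≋ (p *ₚ (q *ₚ r))
  *ₚ-assoc []      q r = ≋-refl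
  *ₚ-assoc (a ∷ p) q r =
    ≋-trans (*ₚ-distribʳ r (scale a q) (0# ∷ (p *ₚ q)))
      (+ₚ-cong (scale-*ₚ a q r) (≋-trans (shift-*ₚ (p *ₚ q) r) (cons-cong refl (*ₚ-assoc p q r))))

  *ₚ-identityˡ : ∀ p → (1ₚ *ₚ p) ≋ p
  *ₚ-identityˡ p = ≋-trans (+ₚ-cong scale-1 (mk λ { zero → refl ; (suc n) → refl })) (+ₚ-identityʳ p)
    where
    scale-1 : scale 1# p ≋ p
    scale-1 = mk λ n → trans (coeff-scale 1# p n) (*-identityˡ _)

  *ₚ-identityʳ : ∀ p → (p *ₚ 1ₚ) ≋ p
  *ₚ-identityʳ p = ≋-trans (*ₚ-comm p 1ₚ) (*ₚ-identityˡ p)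

  PolyRing : CommutativeRing c ℓ
  PolyRing = record
    { Carrier = Poly ; _≈_ = _≋_ ; _+_ = _+ₚ_ ; _*_ = _*ₚ_ ; -_ = -ₚ_ ; 0# = 0ₚ ; 1# = 1ₚ
    ; isCommutativeRing = record
      { isRing = record
        { +-isAbelianGroup = record
          { isGroup = record
            { isMonoid = record
              { isSemigroup = record
                { isMagma = record
                  { isEquivalence = record { refl = ≋-refl ; sym = ≋-sym ; trans = ≋-trans }
                  ; ∙-cong = +ₚ-cong }
                ; assoc = +ₚ-assoc }
              ; identity = (λ p → ≋-refl) , +ₚ-identityʳ }
            ; inverse = +ₚ-inverseˡ , +ₚ-inverseʳ
            ; ⁻¹-cong = -ₚ-cong }
          ; comm = +ₚ-comm }
        ; *-cong = *ₚ-cong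
        ; *-assoc = *ₚ-assoc
        ; *-identity = *ₚ-identityˡ , *ₚ-identityʳ
        ; distrib = *ₚ-distribˡ , *ₚ-distribʳ }
      ; *-comm = *ₚ-comm } }

  module ≈-Reasoning = Relation.Binary.Reasoning.Setoid setoid
  module ≋-Reasoning = Relation.Binary.Reasoning.Setoid (CommutativeRing.setoid PolyRing)

  X-*ₚ : ∀ p → (X *ₚ p) ≋ (0# ∷ p)
  X-*ₚ p = +ₚ-cong zero-scale (cons-cong refl (*ₚ-identityˡ p))
    where
    zero-scale : scale 0# p ≋ 0ₚ
    zero-scale = mk λ n → trans (coeff-scale 0# p n) (zeroˡ _)

module Derivative {c ℓ : Level} (F : Field c ℓ) where
  open Field F hiding (zero)
  open FieldPoly F
  open PolynomialRing F
  import Data.Nat as ℕ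
  import Data.Nat.Properties as ℕₚ
  open import Relation.Binary.PropositionalEquality using (cong) renaming (sym to ≡-sym)
  open import Algebra.Properties.CommutativeSemigroup *-commutativeSemigroup using (x∙yz≈y∙xz)
  open import Algebra.Solver.Ring.NaturalCoefficients.Default (CommutativeRing.commutativeSemiring PolyRing)
    using (solve; _:+_; _:*_; _:=_)

  coeff-derivFrom : ∀ k p n → coeff (derivFrom k p) n ≈ ι (k ℕ.+ n) * coeff p n
  coeff-derivFrom k []      n       = sym (zeroʳ _)
  coeff-derivFrom k (a ∷ p) zero    = *-congʳ (reflexive (cong ι (≡-sym (ℕₚ.+-identityʳ k))))
  coeff-derivFrom k (a ∷ p) (suc n) =
    trans (coeff-derivFrom (suc k) p n) (*-congʳ (reflexive (cong ι (≡-sym (ℕₚ.+-suc k n)))))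

  coeff-deriv : ∀ p n → coeff (deriv p) n ≈ ι (suc n) * coeff p (suc n)
  coeff-deriv []      n = sym (zeroʳ _)
  coeff-deriv (a ∷ p) n = coeff-derivFrom 1 p n

  coeff-X-deriv : ∀ p n → coeff (0# ∷ deriv p) n ≈ ι n * coeff p n
  coeff-X-deriv p zero    = sym (zeroˡ _)
  coeff-X-deriv p (suc n) = coeff-deriv p n

  deriv-cong : ∀ {p q} → p ≋ q → deriv p ≋ deriv q
  deriv-cong {p} {q} h = mk λ n →
    trans (coeff-deriv p n) (trans (*-congˡ (at h (suc n))) (sym (coeff-deriv q n)))

  deriv-+ : ∀ p q → deriv (p +ₚ q) ≋ (deriv p +ₚ deriv q)
  deriv-+ p q = mk λ n → begin
    coeff (deriv (p +ₚ q)) n                           ≈⟨ trans (coeff-deriv (p +ₚ q) n) (*-congˡ (coeff-+ p q (suc n))) ⟩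
    ι (suc n) * (coeff p (suc n) + coeff q (suc n))    ≈⟨ distribˡ _ _ _ ⟩
    ι (suc n) * coeff p (suc n) + ι (suc n) * coeff q (suc n)
                                                       ≈⟨ trans (coeff-+ (deriv p) (deriv q) n) (+-cong (coeff-deriv p n) (coeff-deriv q n)) ⟨
    coeff (deriv p +ₚ deriv q) n                       ∎
    where open ≈-Reasoning

  deriv-scale : ∀ a p → deriv (scale a p) ≋ scale a (deriv p)
  deriv-scale a p = mk λ n → begin
    coeff (deriv (scale a p)) n        ≈⟨ trans (coeff-deriv (scale a p) n) (*-congˡ (coeff-scale a p (suc n))) ⟩
    ι (suc n) * (a * coeff p (suc n))  ≈⟨ x∙yz≈y∙xz _ _ _ ⟩
    a * (ι (suc n) * coeff p (suc n))  ≈⟨ trans (coeff-scale a (deriv p) n) (*-congˡ (coeff-deriv p n)) ⟨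
    coeff (scale a (deriv p)) n        ∎
    where open ≈-Reasoning

  deriv-shift : ∀ r → deriv (0# ∷ r) ≋ (r +ₚ (0# ∷ deriv r))
  deriv-shift r = mk λ n → begin
    coeff (deriv (0# ∷ r)) n               ≈⟨ coeff-deriv (0# ∷ r) n ⟩
    (1# + ι n) * coeff r n                 ≈⟨ distribʳ _ _ _ ⟩
    1# * coeff r n + ι n * coeff r n       ≈⟨ +-cong (*-identityˡ _) (sym (coeff-X-deriv r n)) ⟩
    coeff r n + coeff (0# ∷ deriv r) n     ≈⟨ coeff-+ r (0# ∷ deriv r) n ⟨
    coeff (r +ₚ (0# ∷ deriv r)) n          ∎
    where open ≈-Reasoning

  deriv-*ₚ : ∀ p q → deriv (p *ₚ q) ≋ ((deriv p *ₚ q) +ₚ (p *ₚ deriv q))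
  deriv-*ₚ []       q = ≋-refl
  deriv-*ₚ (a ∷ p₁) q = begin
    deriv (scale a q +ₚ (0# ∷ (p₁ *ₚ q)))              ≈⟨ deriv-+ (scale a q) (0# ∷ (p₁ *ₚ q)) ⟩
    deriv (scale a q) +ₚ deriv (0# ∷ (p₁ *ₚ q))        ≈⟨ +ₚ-cong (deriv-scale a q) (deriv-shift (p₁ *ₚ q)) ⟩
    aq' +ₚ ((p₁ *ₚ q) +ₚ (0# ∷ deriv (p₁ *ₚ q)))       ≈⟨ +ₚ-cong (≋-refl {aq'}) (+ₚ-cong (≋-refl {p₁ *ₚ q}) x[p₁q]') ⟩
    aq' +ₚ ((p₁ *ₚ q) +ₚ (X *ₚ ((p₁' *ₚ q) +ₚ (p₁ *ₚ q'))))
                                                       ≈⟨ rearrange aq' p₁ q X p₁' q' ⟩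
    ((p₁ +ₚ (X *ₚ p₁')) *ₚ q) +ₚ (aq' +ₚ (X *ₚ (p₁ *ₚ q')))
                                                       ≈⟨ +ₚ-cong (*ₚ-congˡ q (≋-sym p')) (+ₚ-cong (≋-refl {aq'}) (X-*ₚ _)) ⟩
    (deriv (a ∷ p₁) *ₚ q) +ₚ ((a ∷ p₁) *ₚ q')          ∎
    where
    open ≋-Reasoning
    q'  = deriv q
    p₁' = deriv p₁
    aq' = scale a q'
    x[p₁q]' : (0# ∷ deriv (p₁ *ₚ q)) ≋ (X *ₚ ((p₁' *ₚ q) +ₚ (p₁ *ₚ q')))
    x[p₁q]' = ≋-trans (cons-cong refl (deriv-*ₚ p₁ q)) (≋-sym (X-*ₚ _))
    p' : deriv (a ∷ p₁) ≋ (p₁ +ₚ (X *ₚ p₁'))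
    p' = ≋-trans (deriv-shift p₁) (+ₚ-cong (≋-refl {p₁}) (≋-sym (X-*ₚ p₁')))
    rearrange : ∀ s p q x p' q' → (s +ₚ ((p *ₚ q) +ₚ (x *ₚ ((p' *ₚ q) +ₚ (p *ₚ q'))))) ≋
                                  (((p +ₚ (x *ₚ p')) *ₚ q) +ₚ (s +ₚ (x *ₚ (p *ₚ q'))))
    rearrange = solve 6 (λ s p q x p' q' → s :+ ((p :* q) :+ (x :* ((p' :* q) :+ (p :* q'))))
                                        := ((p :+ (x :* p')) :* q) :+ (s :+ (x :* (p :* q')))) ≋-refl

module Degree {c ℓ : Level} (F : Field c ℓ) where
  open Field F hiding (zero)
  open FieldPoly F
  open PolynomialRing F
  open Derivative F using (coeff-deriv)
  import Data.Nat as ℕ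
  import Data.Nat.Properties as ℕₚ
  open import Relation.Nullary.Decidable using (yes; no; ¬¬-excluded-middle)

  return : ∀ {a} {A : Set a} → A → ¬ ¬ A
  return x ¬x = ¬x x

  _>>=_ : ∀ {a b} {A : Set a} {B : Set b} → ¬ ¬ A → (A → ¬ ¬ B) → ¬ ¬ B
  (¬¬x >>= f) ¬y = ¬¬x (λ x → f x ¬y)

  zero-or-degree : ∀ p → ¬ ¬ (p ≋ 0ₚ ⊎ ∃ (HasDegree p))
  zero-or-degree []      = return (inj₁ ≋-refl)
  zero-or-degree (a ∷ p) = zero-or-degree p >>= λ
    { (inj₁ p≋0) → ¬¬-excluded-middle >>= λ
        { (yes a≈0) → return (inj₁ (mk λ { zero → a≈0 ; (suc n) → at p≋0 n }))
        ; (no a≉0)  → return (inj₂ (0 , a≉0 , λ { (suc n) _ → at p≋0 n })) }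
    ; (inj₂ (m , lc≉0 , above)) →
        return (inj₂ (suc m , lc≉0 , λ { (suc n) (ℕ.s≤s m<n) → above n m<n })) }

  HasDegree⇒≉0 : ∀ {p m} → HasDegree p m → ¬ (p ≋ 0ₚ)
  HasDegree⇒≉0 (lc≉0 , _) p≋0 = lc≉0 (at p≋0 _)

  DegLT : Poly → ℕ → Set ℓ
  DegLT p m = ∀ n → m ≤ n → coeff p n ≈ 0#

  DegLE-cong : ∀ {p q n} → p ≋ q → DegLE p n → DegLE q n
  DegLE-cong p≋q p≤n m n<m = trans (sym (at p≋q m)) (p≤n m n<m)

  HasDegree-cong : ∀ {p q n} → p ≋ q → HasDegree p n → HasDegree q n
  HasDegree-cong p≋q (lc≉0 , p≤n) = (λ lc≈0 → lc≉0 (trans (at p≋q _) lc≈0)) , DegLE-cong p≋q p≤n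

  MaxDeg-cong : ∀ {p p' q q' d} → p ≋ p' → q ≋ q' → MaxDeg p q d → MaxDeg p' q' d
  MaxDeg-cong p≋p' q≋q' (inj₁ (degp , q≤d)) = inj₁ (HasDegree-cong p≋p' degp , DegLE-cong q≋q' q≤d)
  MaxDeg-cong p≋p' q≋q' (inj₂ (degq , p≤d)) = inj₂ (HasDegree-cong q≋q' degq , DegLE-cong p≋p' p≤d)

  *-≉0 : ∀ {x y} → ¬ (x ≈ 0#) → ¬ (y ≈ 0#) → ¬ (x * y ≈ 0#)
  *-≉0 {x} {y} x≉0 y≉0 xy≈0 with inverse x x≉0
  ... | x⁻¹ , xx⁻¹≈1 = y≉0 (begin
    y               ≈⟨ *-identityˡ y ⟨
    1# * y          ≈⟨ *-congʳ xx⁻¹≈1 ⟨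
    (x * x⁻¹) * y   ≈⟨ *-congʳ (*-comm x x⁻¹) ⟩
    (x⁻¹ * x) * y   ≈⟨ *-assoc x⁻¹ x y ⟩
    x⁻¹ * (x * y)   ≈⟨ *-congˡ xy≈0 ⟩
    x⁻¹ * 0#        ≈⟨ zeroʳ x⁻¹ ⟩
    0#              ∎)
    where open ≈-Reasoning

  constant-*ₚ : ∀ a p q → DegLE (a ∷ p) 0 → ((a ∷ p) *ₚ q) ≋ scale a q
  constant-*ₚ a p q constant = ≋-trans (+ₚ-cong (≋-refl {scale a q}) x·pq≋0) (+ₚ-identityʳ _)
    where
    p≋0 : p ≋ 0ₚ
    p≋0 = mk λ n → constant (suc n) (ℕ.s≤s ℕ.z≤n)
    x·pq≋0 : (0# ∷ (p *ₚ q)) ≋ 0ₚ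
    x·pq≋0 = mk λ { zero → refl ; (suc n) → at (*ₚ-vanishesˡ q p≋0) n }

  coeff-*ₚ-top : ∀ p q m k → DegLE p m → DegLE q k → coeff (p *ₚ q) (m ℕ.+ k) ≈ coeff p m * coeff q k
  coeff-*ₚ-top []      q m       k degp degq = sym (zeroˡ _)
  coeff-*ₚ-top (a ∷ p) q zero    k degp degq = trans (at (constant-*ₚ a p q degp) k) (coeff-scale a q k)
  coeff-*ₚ-top (a ∷ p) q (suc m) k degp degq = begin
    coeff ((a ∷ p) *ₚ q) (suc (m ℕ.+ k))                    ≈⟨ coeff-*-suc a p q (m ℕ.+ k) ⟩
    a * coeff q (suc (m ℕ.+ k)) + coeff (p *ₚ q) (m ℕ.+ k)  ≈⟨ +-cong (trans (*-congˡ q-vanishes) (zeroʳ a)) (coeff-*ₚ-top p q m k degp₁ degq) ⟩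
    0# + coeff p m * coeff q k                              ≈⟨ +-identityˡ _ ⟩
    coeff p m * coeff q k                                   ∎
    where
    open ≈-Reasoning
    q-vanishes : coeff q (suc (m ℕ.+ k)) ≈ 0#
    q-vanishes = degq _ (ℕ.s≤s (ℕₚ.m≤n+m k m))
    degp₁ : DegLE p m
    degp₁ n m<n = degp (suc n) (ℕ.s≤s m<n)

  *ₚ-lc≉0 : ∀ p q {m k} → HasDegree p m → HasDegree q k → ¬ (coeff (p *ₚ q) (m ℕ.+ k) ≈ 0#)
  *ₚ-lc≉0 p q {m} {k} (lcp≉0 , degp) (lcq≉0 , degq) top≈0 =
    *-≉0 lcp≉0 lcq≉0 (trans (sym (coeff-*ₚ-top p q m k degp degq)) top≈0)

  no-zero-divisors : ∀ u w → (u *ₚ w) ≋ 0ₚ → ¬ (u ≋ 0ₚ) → ¬ ¬ (w ≋ 0ₚ)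
  no-zero-divisors u w uw≋0 u≉0 = zero-or-degree u >>= λ
    { (inj₁ u≋0) → ⊥-elim (u≉0 u≋0)
    ; (inj₂ (m , degu)) → zero-or-degree w >>= λ
      { (inj₁ w≋0) → return w≋0
      ; (inj₂ (k , degw)) → ⊥-elim (*ₚ-lc≉0 u w degu degw (at uw≋0 _)) } }

  small-multiple≋0 : ∀ {g w h m} → HasDegree g m → (g *ₚ w) ≋ h → DegLT h m → ¬ ¬ (h ≋ 0ₚ)
  small-multiple≋0 {g} {w} {h} {m} degg gw≋h h<m = zero-or-degree w >>= λ
    { (inj₁ w≋0) → return (≋-trans (≋-sym gw≋h) (≋-trans (*ₚ-congʳ g w≋0) (*ₚ-zeroʳ g)))
    ; (inj₂ (k , degw)) → ⊥-elim (*ₚ-lc≉0 g w degg degw (trans (at gw≋h _) (h<m _ (ℕₚ.m≤m+n m k)))) }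

  constant-*ₚ-DegLT : ∀ {k q m} → DegLE k 0 → DegLT q m → DegLT (k *ₚ q) m
  constant-*ₚ-DegLT {[]}    k≤0 q<m j m≤j = refl
  constant-*ₚ-DegLT {a ∷ k} {q} k≤0 q<m j m≤j =
    trans (at (constant-*ₚ a k q k≤0) j) (trans (coeff-scale a q j) (trans (*-congˡ (q<m j m≤j)) (zeroʳ a)))

  degree-bound : ∀ {v m k} → HasDegree v m → DegLT v k → m ℕ.< k
  degree-bound {v} {m} {k} (lc≉0 , _) v<k with m ℕ.<? k
  ... | yes m<k = m<k
  ... | no m≮k  = ⊥-elim (lc≉0 (v<k m (ℕₚ.≮⇒≥ m≮k)))

  deriv-DegLT : ∀ {g m} → DegLE g m → DegLT (deriv g) m
  deriv-DegLT {g} g≤m j m≤j = trans (coeff-deriv g j) (trans (*-congˡ (g≤m (suc j) (ℕ.s≤s m≤j))) (zeroʳ _))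

module Euclid {c ℓ : Level} (F : Field c ℓ) where
  open Field F hiding (zero)
  open FieldPoly F
  open PolynomialRing F
  open Degree F
  import Data.Nat as ℕ
  import Data.Nat.Properties as ℕₚ
  import Relation.Binary.PropositionalEquality as ≡
  open import Algebra.Properties.Group +-group using (ε⁻¹≈ε)
  open CommutativeRingFacts PolyRing using ([x+y]+[z-x]≈z+y; euclid-divides; euclid-bézout)

  division : ∀ u v m → HasDegree v m → ∃ λ Q → ∃ λ r → u ≋ ((Q *ₚ v) +ₚ r) × DegLT r m
  division []       v m degv = 0ₚ , 0ₚ , ≋-refl , λ _ _ → refl
  division (a ∷ u₁) v m degv@(lc≉0 , v≤m) with inverse (coeff v m) lc≉0 | division u₁ v m degv
  ... | lc⁻¹ , lc*lc⁻¹≈1 | Q₁ , r₁ , u₁≋Q₁v+r₁ , r₁<m = (κ ∷ Q₁) , (t -ₚ κv) , u≋Qv+r , r<m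
    where
    -- t = a + x r₁ has degree ≤ m; subtracting κ v removes its x^m term.
    t = a ∷ r₁
    κ = coeff t m * lc⁻¹
    κv = scale κ v
    xQ₁v = 0# ∷ (Q₁ *ₚ v)
    u≋Qv+r : (a ∷ u₁) ≋ (((κ ∷ Q₁) *ₚ v) +ₚ (t -ₚ κv))
    u≋Qv+r = ≋-trans (cons-cong (sym (+-identityˡ a)) u₁≋Q₁v+r₁)
               (≋-trans (+ₚ-comm xQ₁v t) (≋-sym ([x+y]+[z-x]≈z+y κv xQ₁v t)))
    coeff-r : ∀ j → coeff (t -ₚ κv) j ≈ coeff t j - κ * coeff v j
    coeff-r j = trans (coeff-+ t (-ₚ κv) j) (+-congˡ (trans (coeff-neg κv j) (-‿cong (coeff-scale κ v j))))
    κ*lc≈tₘ : κ * coeff v m ≈ coeff t m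
    κ*lc≈tₘ = trans (*-assoc _ _ _) (trans (*-congˡ (trans (*-comm _ _) lc*lc⁻¹≈1)) (*-identityʳ _))
    r<m : DegLT (t -ₚ κv) m
    r<m j m≤j with ℕₚ.m≤n⇒m<n∨m≡n m≤j
    ... | inj₂ ≡.refl = trans (coeff-r m) (trans (+-congˡ (-‿cong κ*lc≈tₘ)) (-‿inverseʳ _))
    r<m (suc j) m≤j | inj₁ m<j = trans (coeff-r (suc j))
      (trans (+-cong (r₁<m j (ℕₚ.≤-pred m<j)) (-‿cong (trans (*-congˡ (v≤m (suc j) m<j)) (zeroʳ κ))))
             (trans (+-identityˡ _) ε⁻¹≈ε))

  record GCD (u v : Poly) : Set (c ⊔ ℓ) where
    field
      gcd           : Poly
      divides-left  : ∃ λ u' → (gcd *ₚ u') ≋ u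
      divides-right : ∃ λ v' → (gcd *ₚ v') ≋ v
      s t           : Poly
      bézout        : ((s *ₚ u) +ₚ (t *ₚ v)) ≋ gcd

  gcd-with-zero : ∀ u v → v ≋ 0ₚ → GCD u v
  gcd-with-zero u v v≋0 = record
    { gcd           = u
    ; divides-left  = 1ₚ , *ₚ-identityʳ u
    ; divides-right = 0ₚ , ≋-trans (*ₚ-zeroʳ u) (≋-sym v≋0)
    ; s             = 1ₚ
    ; t             = 0ₚ
    ; bézout        = ≋-trans (+ₚ-identityʳ _) (*ₚ-identityˡ u)
    }

  gcd-step : ∀ {u v Q r} → u ≋ ((Q *ₚ v) +ₚ r) → GCD v r → GCD u v
  gcd-step {u} {v} {Q} {r} u≋Qv+r G = record
    { gcd           = gcd
    ; divides-left  = (Q *ₚ v') +ₚ r' , euclid-divides {Q = Q} {k = gcd} {v' = v'} {r' = r'} u≋Qv+r kv'≋v kr'≋r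
    ; divides-right = v' , kv'≋v
    ; s             = t
    ; t             = s -ₚ (t *ₚ Q)
    ; bézout        = euclid-bézout {r = r} {Q = Q} {s = s} {t = t} u≋Qv+r bézout
    }
    where
    open GCD G
    v' = proj₁ divides-left
    kv'≋v = proj₂ divides-left
    r' = proj₁ divides-right
    kr'≋r = proj₂ divides-right

  -- Euclid's algorithm, by recursion on a bound n > deg v.
  gcd-exists : ∀ n u v → DegLT v n → ¬ ¬ GCD u v
  gcd-exists zero    u v v<0 = return (gcd-with-zero u v (mk λ j → v<0 j ℕ.z≤n))
  gcd-exists (suc n) u v v<n+1 = zero-or-degree v >>= λ
    { (inj₁ v≋0)        → return (gcd-with-zero u v v≋0)
    ; (inj₂ (m , degv)) → euclid-step m degv (division u v m degv) }
    where
    euclid-step : ∀ m → HasDegree v m → (∃ λ Q → ∃ λ r → u ≋ ((Q *ₚ v) +ₚ r) × DegLT r m) → ¬ ¬ GCD u v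
    euclid-step m degv (Q , r , u≋Qv+r , r<m) =
      gcd-exists n v r (λ j n≤j → r<m j (ℕₚ.≤-trans (ℕₚ.≤-pred (degree-bound {v} degv v<n+1)) n≤j)) >>= λ G →
      return (gcd-step {Q = Q} u≋Qv+r G)

module NewtonMap {c ℓ : Level} (F : Field c ℓ) where
  open Field F hiding (zero)
  open FieldPoly F
  open PolynomialRing F
  open Derivative F
  open Degree F
  open Euclid F
  import Data.Nat as ℕ
  import Data.Nat.Properties as ℕₚ
  import Relation.Binary.PropositionalEquality as ≡
  open import Algebra.Properties.Ring ring using (x∙y⁻¹≈ε⇒x≈y; x+x≈x⇒x≈0)
  open import Algebra.Properties.Group (CommutativeRing.+-group PolyRing) using ()
    renaming (x∙y⁻¹≈ε⇒x≈y to x-y≋0⇒x≋y)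
  open CommutativeRingFacts PolyRing
    using (x-[x-y]≈y; common-cofactor; newton-factor; [q-a]g≈b; bézout-cofactor; annihilated; square-divides-product)

  newton-factorisation : ∀ {f p q} → Coprime p q → (p *ₚ deriv f) ≋ (q *ₚ ((X *ₚ deriv f) -ₚ f)) →
                         ∃ λ g → (((X *ₚ q) -ₚ p) *ₚ g) ≋ f × (q *ₚ g) ≋ deriv f
  newton-factorisation {f} {p} {q} (α , β , bézout) cross =
    g , newton-factor {X} {p} {q} {g} pg≋N qg≋f' , qg≋f'
    where
    N g : Poly
    N = (X *ₚ deriv f) -ₚ f
    g = (β *ₚ deriv f) +ₚ (α *ₚ N)
    cofactor : (p *ₚ g) ≋ N × (q *ₚ g) ≋ deriv f
    cofactor = common-cofactor {p} {q} {N} {deriv f} {α} {β} (mk bézout) cross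
    pg≋N = proj₁ cofactor
    qg≋f' = proj₂ cofactor

  leibniz-cofactor : ∀ {f A g q} → (A *ₚ g) ≋ f → (q *ₚ g) ≋ deriv f → ((q -ₚ deriv A) *ₚ g) ≋ (A *ₚ deriv g)
  leibniz-cofactor {f} {A} {g} {q} Ag≋f qg≋f' =
    [q-a]g≈b {q} {deriv A} (≋-trans qg≋f' (≋-trans (deriv-cong (≋-sym Ag≋f)) (deriv-*ₚ A g)))

  -- If e g = A g' and a nonzero constant k is a combination s A + t g, then e = 0:
  -- g divides k g', which has smaller degree than g.
  constant-gcd⇒≋0 : ∀ {A g e k m} s t → HasDegree g m → HasDegree k 0 →
                    (e *ₚ g) ≋ (A *ₚ deriv g) → ((s *ₚ A) +ₚ (t *ₚ g)) ≋ k → ¬ ¬ (e ≋ 0ₚ)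
  constant-gcd⇒≋0 {A} {g} {e} {k} s t degg degk eg≋Ag' bézout =
    small-multiple≋0 {g} degg (bézout-cofactor {e} {g} {A} {deriv g} {s} {t} {k} eg≋Ag' bézout)
      (constant-*ₚ-DegLT {k} (proj₂ degk) (deriv-DegLT {g} (proj₂ degg))) >>= λ kg'≋0 →
    no-zero-divisors g (k *ₚ e) (annihilated {e} {g} {A} {deriv g} {k} eg≋Ag' kg'≋0) (HasDegree⇒≉0 degg) >>= λ ke≋0 →
    no-zero-divisors k e ke≋0 (HasDegree⇒≉0 degk)

  -- In a squarefree product f = A g, a relation e g = A g' forces e = 0: the
  -- factors A and g are coprime, since a nonconstant common factor would occur
  -- squared in f.
  squarefree-cofactor : ∀ {f A g e} → Squarefree f → (A *ₚ g) ≋ f → (e *ₚ g) ≋ (A *ₚ deriv g) → ¬ ¬ (e ≋ 0ₚ)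
  squarefree-cofactor {f} {A} {g} {e} (f≉0 , no-square) Ag≋f eg≋Ag' = zero-or-degree g >>= λ
    { (inj₁ g≋0)        → ⊥-elim (f≉0 (at (≋-trans (≋-sym Ag≋f) (≋-trans (*ₚ-congʳ A g≋0) (*ₚ-zeroʳ A)))))
    ; (inj₂ (m , degg)) → gcd-exists (suc m) A g (proj₂ degg) >>= coprime-factors degg }
    where
    coprime-factors : ∀ {m} → HasDegree g m → GCD A g → ¬ ¬ (e ≋ 0ₚ)
    coprime-factors degg G = zero-or-degree gcd >>= λ
      { (inj₁ k≋0)           → ⊥-elim (HasDegree⇒≉0 degg (≋-trans (≋-sym kg'≋g) (*ₚ-vanishesˡ g' k≋0)))
      ; (inj₂ (zero , degk))  → constant-gcd⇒≋0 s t degg degk eg≋Ag' bézout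
      ; (inj₂ (suc j , degk)) → ⊥-elim (no-square gcd (suc j , ℕ.s≤s ℕ.z≤n , degk)
                                  (A' *ₚ g' , at (≋-trans (square-divides-product {gcd} {A'} {g'} kA'≋A kg'≋g) Ag≋f))) }
      where
      open GCD G
      A' = proj₁ divides-left
      kA'≋A = proj₂ divides-left
      g' = proj₁ divides-right
      kg'≋g = proj₂ divides-right

  newton-numerator : Poly → Poly
  newton-numerator A = (X *ₚ deriv A) -ₚ A

  coeff-newton-numerator : ∀ A n → coeff (newton-numerator A) n ≈ ι n * coeff A n - coeff A n
  coeff-newton-numerator A n = trans (coeff-+ (X *ₚ deriv A) (-ₚ A) n)
    (+-cong (trans (at (X-*ₚ (deriv A)) n) (coeff-X-deriv A n)) (coeff-neg A n))

  newton-numerator-coeff≈0 : ∀ A {d} → ι d ≈ 1# → coeff (newton-numerator A) d ≈ 0#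
  newton-numerator-coeff≈0 A {d} ιd≈1 = trans (coeff-newton-numerator A d)
    (trans (+-congʳ (trans (*-congʳ ιd≈1) (*-identityˡ _))) (-‿inverseʳ _))

  -- Let deg A = e + 1 with leading coefficient lc. If both x A' − A and A' have
  -- degree ≤ d ≤ e, then (e + 1) lc = lc from x A' − A, while from A' either
  -- (e + 1) lc = 0 (if d < e) or, as d = e and d = 1 in L, (e + 1) lc = 2 lc.
  -- Either way lc = 0, which is absurd.
  newton-top-coeffs : ∀ {A e d} → HasDegree A (suc e) → ι d ≈ 1# → d ≤ e →
                      DegLE (newton-numerator A) d → DegLE (deriv A) d → ⊥
  newton-top-coeffs {A} {e} {d} (lc≉0 , _) ιd≈1 d≤e num≤d A'≤d = lc≉0 (lc≈0 (ℕₚ.m≤n⇒m<n∨m≡n d≤e))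
    where
    open ≈-Reasoning
    lc = coeff A (suc e)
    ι·lc≈lc : ι (suc e) * lc ≈ lc
    ι·lc≈lc = x∙y⁻¹≈ε⇒x≈y _ _ (trans (sym (coeff-newton-numerator A (suc e))) (num≤d (suc e) (ℕ.s≤s d≤e)))
    lc≈0 : d ℕ.< e ⊎ d ≡.≡ e → lc ≈ 0#
    lc≈0 (inj₁ d<e) = trans (sym ι·lc≈lc) (trans (sym (coeff-deriv A e)) (A'≤d e d<e))
    lc≈0 (inj₂ d≡e) = x+x≈x⇒x≈0 lc (begin
      lc + lc            ≈⟨ +-cong (*-identityˡ lc) (*-identityˡ lc) ⟨
      1# * lc + 1# * lc  ≈⟨ distribʳ lc 1# 1# ⟨
      (1# + 1#) * lc     ≈⟨ *-congʳ (+-congˡ (≡.subst (λ n → ι n ≈ 1#) d≡e ιd≈1)) ⟨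
      (1# + ι e) * lc    ≈⟨ ι·lc≈lc ⟩
      lc                 ∎)

  newton-not-of-degree : ∀ A {a d} → HasDegree A a → ι d ≈ 1# → ¬ MaxDeg (newton-numerator A) (deriv A) d
  newton-not-of-degree A _ ιd≈1 (inj₁ ((num-lc≉0 , _) , _)) = num-lc≉0 (newton-numerator-coeff≈0 A ιd≈1)
  newton-not-of-degree A degA ιd≈1 (inj₂ (degA' , num≤d)) with degree-bound {deriv A} degA' (deriv-DegLT {A} (proj₂ degA))
  ... | ℕ.s≤s d≤e = newton-top-coeffs {A} degA ιd≈1 d≤e num≤d (proj₂ degA')

  no-newton-map-of-degree : ∀ {f d} → ι d ≈ 1# → Squarefree f → ¬ NewtonDegree f d
  no-newton-map-of-degree {f} {d} ιd≈1 squarefree (_ , p , q , _ , coprime , cross , maxdeg) =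
    ¬¬⊥⇒⊥ (
      squarefree-cofactor {f} {A} {g} squarefree Ag≋f (leibniz-cofactor {f} {A} {g} {q} Ag≋f qg≋f') >>= λ q-A'≋0 →
      zero-or-degree A >>= λ
        { (inj₁ A≋0)        → return (proj₁ squarefree (at (≋-trans (≋-sym Ag≋f) (*ₚ-vanishesˡ g A≋0))))
        ; (inj₂ (a , degA)) → return (newton-not-of-degree A degA ιd≈1 (reduced-form q-A'≋0)) })
    where
    A : Poly
    A = (X *ₚ q) -ₚ p
    factorisation : ∃ λ g → (A *ₚ g) ≋ f × (q *ₚ g) ≋ deriv f
    factorisation = newton-factorisation {f} {p} {q} coprime (mk cross)
    g = proj₁ factorisation
    Ag≋f = proj₁ (proj₂ factorisation)
    qg≋f' = proj₂ (proj₂ factorisation)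
    -- Once q = A', also p = x q − A = x A' − A: (p, q) is the Newton map of A.
    reduced-form : (q -ₚ deriv A) ≋ 0ₚ → MaxDeg (newton-numerator A) (deriv A) d
    reduced-form q-A'≋0 = MaxDeg-cong p≋xA'-A q≋A' maxdeg
      where
      q≋A' = x-y≋0⇒x≋y q (deriv A) q-A'≋0
      p≋xA'-A = ≋-trans (≋-sym (x-[x-y]≈y (X *ₚ q) p)) (+ₚ-cong (*ₚ-congʳ X q≋A') (≋-refl { -ₚ A}))
    ¬¬⊥⇒⊥ : ¬ ¬ ⊥ → ⊥
    ¬¬⊥⇒⊥ ¬¬⊥ = ¬¬⊥ (λ ())

corollary2p5 : ∀ {c ℓ} (F : Field c ℓ) → FieldPoly.SeparablyClosed F →
    (d : ℕ) → 2 ≤ d → Field._≈_ F (FieldPoly.ι F d) (Field.1# F) →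
    ¬ (∃ λ f → FieldPoly.Squarefree F f ×
         (∃ λ n → (2 ≤ n) × FieldPoly.HasDegree F f n) ×
         FieldPoly.NewtonDegree F f d)
corollary2p5 F _ d _ ιd≈1 (f , squarefree , _ , newton) =
  NewtonMap.no-newton-map-of-degree F {f} ιd≈1 squarefree newton
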